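{- Let $(A,B)$ be a bimatrix game with $A,B\in\mathbb{Q}_{\ge0}^{n\times n}$ and let $G$ be its associated graph. If $(x,y)$ is a minimal Nash equilibrium of $(A,B)$, then either $|S(x)|=|S(y)|=1$, or the subgraph of $G$ induced by $S(x)\cup S(y)$ is connected.
   Context: Bimatrix game: the row player picks a probability vector $x$ over rows $[n]$, the column player a probability vector $y$ over columns $[n]$; payoffs $x^TAy$ and $x^TBy$. $(x,y)$ is a Nash equilibrium if neither player can strictly increase his payoff by unilaterally changing strategy. $S(x)=\{i:x_i>0\}$ is the support. A Nash equilibrium $(x,y)$ is minimal if every Nash equilibrium $(x',y')$ with $S(x')\subseteq S(x)$ and $S(y')\subseteq S(y)$ satisfies $S(x')=S(x)$ and $S(y')=S(y)$. The associated graph $G$ is bipartite with row vertices $V_r=[n]$ and column vertices $V_c=[n]$, row $i$ adjacent to column $j$ iff $A_{i,j}\ne0$ or $B_{i,j}\ne0$; $S(x)$ is viewed as a set of row vertices and $S(y)$ as a set of column vertices. -}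

module Defs where

open import Data.Nat using (ℕ; zero; suc)
open import Data.Fin using (Fin; zero; suc)
open import Data.Rational using (ℚ; 0ℚ; 1ℚ; _+_; _*_; _≤_; _<_)
open import Data.Sum using (_⊎_; inj₁; inj₂)
open import Data.Product using (_×_; ∃)
open import Relation.Binary.PropositionalEquality using (_≡_)
open import Relation.Nullary using (¬_)
open import Data.Empty using (⊥)
open import Relation.Binary.Construct.Closure.ReflexiveTransitive using (Star)

Matrix : ℕ → Set
Matrix n = Fin n → Fin n → ℚ

Σ : ∀ {n} → (Fin n → ℚ) → ℚ
Σ {zero}  f = 0ℚ
Σ {suc n} f = f zero + Σ (λ i → f (suc i))

NonNegMatrix : ∀ {n} → Matrix n → Set
NonNegMatrix A = ∀ i j → 0ℚ ≤ A i j

IsMixed : ∀ {n} → (Fin n → ℚ) → Set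
IsMixed x = (∀ i → 0ℚ ≤ x i) × Σ x ≡ 1ℚ

payoff : ∀ {n} → Matrix n → (Fin n → ℚ) → (Fin n → ℚ) → ℚ
payoff M x y = Σ (λ i → Σ (λ j → x i * M i j * y j))

IsNash : ∀ {n} → Matrix n → Matrix n → (Fin n → ℚ) → (Fin n → ℚ) → Set
IsNash A B x y =
  IsMixed x × IsMixed y ×
  (∀ x' → IsMixed x' → payoff A x' y ≤ payoff A x y) ×
  (∀ y' → IsMixed y' → payoff B x y' ≤ payoff B x y)

InSupport : ∀ {n} → (Fin n → ℚ) → Fin n → Set
InSupport x i = 0ℚ < x i

SuppSubset : ∀ {n} → (Fin n → ℚ) → (Fin n → ℚ) → Set
SuppSubset x' x = ∀ i → InSupport x' i → InSupport x i

SuppEq : ∀ {n} → (Fin n → ℚ) → (Fin n → ℚ) → Set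
SuppEq x' x = SuppSubset x' x × SuppSubset x x'

IsMinimalNash : ∀ {n} → Matrix n → Matrix n → (Fin n → ℚ) → (Fin n → ℚ) → Set
IsMinimalNash A B x y =
  IsNash A B x y ×
  (∀ x' y' → IsNash A B x' y' → SuppSubset x' x → SuppSubset y' y →
     SuppEq x' x × SuppEq y' y)

SupportSizeOne : ∀ {n} → (Fin n → ℚ) → Set
SupportSizeOne x = ∃ λ i → InSupport x i × (∀ k → InSupport x k → k ≡ i)

-- associated bipartite graph: vertices are rows (inj₁) and columns (inj₂)
Vertex : ℕ → Set
Vertex n = Fin n ⊎ Fin n

RCAdj : ∀ {n} → Matrix n → Matrix n → Fin n → Fin n → Set
RCAdj A B i j = (¬ A i j ≡ 0ℚ) ⊎ (¬ B i j ≡ 0ℚ)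

Adj : ∀ {n} → Matrix n → Matrix n → Vertex n → Vertex n → Set
Adj A B (inj₁ i) (inj₂ j) = RCAdj A B i j
Adj A B (inj₂ j) (inj₁ i) = RCAdj A B i j
Adj A B (inj₁ _) (inj₁ _) = ⊥
Adj A B (inj₂ _) (inj₂ _) = ⊥

InSxSy : ∀ {n} → (Fin n → ℚ) → (Fin n → ℚ) → Vertex n → Set
InSxSy x y (inj₁ i) = InSupport x i
InSxSy x y (inj₂ j) = InSupport y j

InducedEdge : ∀ {n} → Matrix n → Matrix n → (Fin n → ℚ) → (Fin n → ℚ) →
              Vertex n → Vertex n → Set
InducedEdge A B x y u v = InSxSy x y u × InSxSy x y v × Adj A B u v

InducedConnected : ∀ {n} → Matrix n → Matrix n → (Fin n → ℚ) → (Fin n → ℚ) → Set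
InducedConnected A B x y =
  ∀ u v → InSxSy x y u → InSxSy x y v → Star (InducedEdge A B x y) u v

-- Let (x, y) be a minimal Nash equilibrium of a game (A, B) with nonnegative
-- payoff matrices, and let R be a set of vertices of the associated graph that
-- is closed under the edges of the induced subgraph G[S(x) ∪ S(y)] and meets
-- both S(x) and S(y).  Restricting x to the rows of R and y to the columns of R
-- and renormalising yields again a Nash equilibrium: no retained row of S(x)
-- puts A-weight on a discarded column of S(y) (and symmetrically for B), so
-- every retained row still attains the best row value against the restricted
-- column strategy, while nonnegativity prevents any row from exceeding it.
-- Minimality then forces S(x) ∪ S(y) ⊆ R.
--
-- Fix i₀ ∈ S(x) and j₀ ∈ S(y).  If i₀ or j₀ lies on an edge of the induced
-- subgraph, the connected component of that edge is such a set R, so every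
-- support vertex is reachable from it.  Otherwise {i₀, j₀} itself is closed,
-- whence S(x) = {i₀} and S(y) = {j₀}.
module Submission where

open import Defs
open import Level using (Level; 0ℓ)
open import Algebra.Bundles using (CommutativeRing)
open import Data.Bool using (if_then_else_)
open import Data.Fin using (Fin; zero; suc; join; splitAt)
open import Data.Fin.Properties as Fin using (any?; splitAt-join)
open import Data.Fin.Subset using (Subset; _∈_; _∉_; _⊂_; _∪_; ⁅_⁆; ∣_∣)
open import Data.Fin.Subset.Properties
  using (_∈?_; ∣p∣≤n; p⊂q⇒∣p∣<∣q∣; p⊆p∪q; q⊆p∪q; x∈p∪q⁻; x∈⁅x⁆; x∈⁅y⁆⇒x≡y; ∣⁅x⁆∣≡1)
open import Data.Nat as ℕ using (ℕ)
import Data.Nat.Properties as ℕ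
open import Data.Product using (_×_; _,_; proj₁; proj₂; ∃; ∃₂)
open import Data.Rational
  using (ℚ; 0ℚ; 1ℚ; _+_; _*_; _≤_; _<_; 1/_; NonZero; positive; nonNegative)
open import Data.Rational.Properties
  using ( +-*-commutativeRing; _<?_; _≟_; ≤-refl; ≤-trans; ≤-reflexive; <⇒≤; ≮⇒≥
        ; <-≤-trans; <-irrefl; ≤-antisym; +-mono-≤; +-mono-<-≤; +-mono-≤-<
        ; +-identityˡ; +-identityʳ; *-comm; *-assoc; *-zeroˡ; *-zeroʳ; *-identityˡ; *-identityʳ
        ; *-monoˡ-≤-nonNeg; *-monoʳ-<-pos; *-inverseˡ; pos⇒nonZero; 1/pos⇒pos; positive⁻¹
        ; module ≤-Reasoning )
open import Data.Sum using (_⊎_; inj₁; inj₂)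
open import Data.Sum.Properties using (≡-dec)
open import Function using (_∘_)
open import Relation.Binary using (Rel; Decidable)
open import Relation.Binary.Construct.Closure.ReflexiveTransitive
  using (Star; ε; _◅_; _◅◅_; gmap; reverse)
open import Relation.Binary.PropositionalEquality
  using (_≡_; refl; sym; trans; cong; cong₂; subst; subst₂; module ≡-Reasoning)
open import Relation.Nullary using (¬_; Dec; yes; no; does; contradiction)
open import Relation.Nullary.Decidable using (decidable-stable; _×-dec_; _⊎-dec_; ¬?)
open import Relation.Unary using (Pred) renaming (Decidable to DecidablePred)

open import Algebra.Properties.Semiring.Sum (CommutativeRing.semiring +-*-commutativeRing)
  using (sum; ∑-comm; *-distribˡ-sum; sum-cong-≗; sum-replicate-zero)

private
  variable
    n : ℕ
    ℓ : Level

<⇒≱ : {a b : ℚ} → a < b → ¬ b ≤ a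
<⇒≱ a<b b≤a = <-irrefl refl (<-≤-trans a<b b≤a)

-- Defs.Σ is the library's semiring sum, so its algebraic laws can be imported.
Σ≡sum : (f : Fin n → ℚ) → Σ f ≡ sum f
Σ≡sum {ℕ.zero}  f = refl
Σ≡sum {ℕ.suc n} f = cong (f zero +_) (Σ≡sum (f ∘ suc))

Σ-cong : {f g : Fin n → ℚ} → (∀ i → f i ≡ g i) → Σ f ≡ Σ g
Σ-cong {f = f} {g} f≗g = trans (Σ≡sum f) (trans (sum-cong-≗ f≗g) (sym (Σ≡sum g)))

Σ-zero : ∀ n → Σ {n} (λ _ → 0ℚ) ≡ 0ℚ
Σ-zero n = trans (Σ≡sum {n} (λ _ → 0ℚ)) (sum-replicate-zero n)

Σ-*ˡ : (c : ℚ) (f : Fin n → ℚ) → Σ (λ i → c * f i) ≡ c * Σ f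
Σ-*ˡ c f = trans (Σ≡sum (λ i → c * f i)) (trans (sym (*-distribˡ-sum c f)) (cong (c *_) (sym (Σ≡sum f))))

Σ-swap : (f : Fin n → Fin n → ℚ) →
         Σ (λ i → Σ (λ j → f i j)) ≡ Σ (λ j → Σ (λ i → f i j))
Σ-swap f = begin
  Σ (λ i → Σ (f i))               ≡⟨ Σ-cong (λ i → Σ≡sum (f i)) ⟩
  Σ (λ i → sum (f i))             ≡⟨ Σ≡sum (λ i → sum (f i)) ⟩
  sum (λ i → sum (f i))           ≡⟨ ∑-comm f ⟩
  sum (λ j → sum (λ i → f i j))   ≡⟨ sym (Σ≡sum (λ j → sum (λ i → f i j))) ⟩
  Σ (λ j → sum (λ i → f i j))     ≡⟨ Σ-cong (λ j → sym (Σ≡sum (λ i → f i j))) ⟩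
  Σ (λ j → Σ (λ i → f i j))       ∎
  where open ≡-Reasoning

Σ-mono : {f g : Fin n → ℚ} → (∀ i → f i ≤ g i) → Σ f ≤ Σ g
Σ-mono {ℕ.zero}  f≤g = ≤-refl
Σ-mono {ℕ.suc n} f≤g = +-mono-≤ (f≤g zero) (Σ-mono (f≤g ∘ suc))

Σ-mono-< : {f g : Fin n → ℚ} → (∀ i → f i ≤ g i) → ∀ k → f k < g k → Σ f < Σ g
Σ-mono-< f≤g zero    fk<gk = +-mono-<-≤ fk<gk (Σ-mono (f≤g ∘ suc))
Σ-mono-< f≤g (suc k) fk<gk = +-mono-≤-< (f≤g zero) (Σ-mono-< (f≤g ∘ suc) k fk<gk)

Σ-pos : {f : Fin n → ℚ} → (∀ i → 0ℚ ≤ f i) → ∀ k → 0ℚ < f k → 0ℚ < Σ f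
Σ-pos {n} {f} f≥0 k fk>0 = subst (_< Σ f) (Σ-zero n) (Σ-mono-< f≥0 k fk>0)

positive-term : (f : Fin n → ℚ) → 0ℚ < Σ f → ∃ λ i → 0ℚ < f i
positive-term {n} f Σf>0 with any? (λ i → 0ℚ <? f i)
... | yes found = found
... | no none   = contradiction Σf≤0 (<⇒≱ Σf>0)
  where
  Σf≤0 : Σ f ≤ 0ℚ
  Σf≤0 = subst (Σ f ≤_) (Σ-zero n) (Σ-mono λ i → ≮⇒≥ λ fi>0 → none (i , fi>0))

nonNeg-≯0⇒≡0 : {a : ℚ} → 0ℚ ≤ a → ¬ 0ℚ < a → a ≡ 0ℚ
nonNeg-≯0⇒≡0 a≥0 a≯0 = ≤-antisym (≮⇒≥ a≯0) a≥0

*-nonNeg : {a b : ℚ} → 0ℚ ≤ a → 0ℚ ≤ b → 0ℚ ≤ a * b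
*-nonNeg {a} {b} a≥0 b≥0 = subst (_≤ a * b) (*-zeroʳ a) (*-monoˡ-≤-nonNeg a {{nonNegative a≥0}} b≥0)

*-monoˡ-≤ : {a p q : ℚ} → 0ℚ ≤ a → p ≤ q → a * p ≤ a * q
*-monoˡ-≤ {a} a≥0 = *-monoˡ-≤-nonNeg a {{nonNegative a≥0}}

*-pos⇒posʳ : {a b : ℚ} → 0ℚ ≤ a → 0ℚ < a * b → 0ℚ < b
*-pos⇒posʳ {a} {b} a≥0 ab>0 with 0ℚ <? b
*-pos⇒posʳ {a} {b} a≥0 ab>0 | yes b>0 = b>0
*-pos⇒posʳ {a} {b} a≥0 ab>0 | no  b≯0 = contradiction ab≤0 (<⇒≱ ab>0)
  where
  ab≤0 : a * b ≤ 0ℚ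
  ab≤0 = subst (a * b ≤_) (*-zeroʳ a) (*-monoˡ-≤ a≥0 (≮⇒≥ b≯0))

weighted-cong : {w f g : Fin n → ℚ} → (∀ i → 0ℚ ≤ w i) →
                (∀ i → 0ℚ < w i → f i ≡ g i) → ∀ i → w i * f i ≡ w i * g i
weighted-cong {w = w} {f} {g} w≥0 agree i with 0ℚ <? w i
... | yes wi>0 = cong (w i *_) (agree i wi>0)
... | no  wi≯0 rewrite nonNeg-≯0⇒≡0 (w≥0 i) wi≯0 = trans (*-zeroˡ (f i)) (sym (*-zeroˡ (g i)))

average-const : {x : Fin n → ℚ} → IsMixed x → (c : ℚ) → Σ (λ i → x i * c) ≡ c
average-const {x = x} (_ , Σx≡1) c = begin
  Σ (λ i → x i * c)  ≡⟨ Σ-cong (λ i → *-comm (x i) c) ⟩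
  Σ (λ i → c * x i)  ≡⟨ Σ-*ˡ c x ⟩
  c * Σ x            ≡⟨ cong (c *_) Σx≡1 ⟩
  c * 1ℚ             ≡⟨ *-identityʳ c ⟩
  c                  ∎
  where open ≡-Reasoning

average-≤ : {x f : Fin n → ℚ} {c : ℚ} → IsMixed x → (∀ i → f i ≤ c) →
            Σ (λ i → x i * f i) ≤ c
average-≤ {c = c} x-mixed f≤c =
  ≤-trans (Σ-mono λ i → *-monoˡ-≤ (proj₁ x-mixed i) (f≤c i)) (≤-reflexive (average-const x-mixed c))

average-≡⇒const : {x f : Fin n → ℚ} {c : ℚ} → IsMixed x → (∀ i → f i ≤ c) →
                  c ≤ Σ (λ i → x i * f i) → ∀ k → 0ℚ < x k → f k ≡ c
average-≡⇒const {x = x} {f} {c} x-mixed f≤c c≤avg k xk>0 with f k <? c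
... | no  fk≮c = ≤-antisym (f≤c k) (≮⇒≥ fk≮c)
... | yes fk<c = contradiction c≤avg (<⇒≱ avg<c)
  where
  avg<c : Σ (λ i → x i * f i) < c
  avg<c = <-≤-trans
    (Σ-mono-< (λ i → *-monoˡ-≤ (proj₁ x-mixed i) (f≤c i)) k (*-monoʳ-<-pos (x k) {{positive xk>0}} fk<c))
    (≤-reflexive (average-const x-mixed c))

pure : Fin n → Fin n → ℚ
pure zero    zero    = 1ℚ
pure zero    (suc _) = 0ℚ
pure (suc _) zero    = 0ℚ
pure (suc k) (suc i) = pure k i

Σ-pure : (k : Fin n) (f : Fin n → ℚ) → Σ (λ i → pure k i * f i) ≡ f k
Σ-pure {ℕ.suc n} zero f = begin
  1ℚ * f zero + Σ (λ i → 0ℚ * f (suc i))  ≡⟨ cong₂ _+_ (*-identityˡ (f zero)) (Σ-cong (λ i → *-zeroˡ (f (suc i)))) ⟩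
  f zero + Σ {n} (λ _ → 0ℚ)              ≡⟨ cong (f zero +_) (Σ-zero n) ⟩
  f zero + 0ℚ                            ≡⟨ +-identityʳ (f zero) ⟩
  f zero                                 ∎
  where open ≡-Reasoning
Σ-pure (suc k) f = begin
  0ℚ * f zero + Σ (λ i → pure k i * f (suc i))  ≡⟨ cong (_+ Σ (λ i → pure k i * f (suc i))) (*-zeroˡ (f zero)) ⟩
  0ℚ + Σ (λ i → pure k i * f (suc i))           ≡⟨ +-identityˡ _ ⟩
  Σ (λ i → pure k i * f (suc i))                ≡⟨ Σ-pure k (f ∘ suc) ⟩
  f (suc k)                                     ∎
  where open ≡-Reasoning

pure-mixed : (k : Fin n) → IsMixed (pure k)
pure-mixed k = pure-nonNeg k , trans (Σ-cong λ i → sym (*-identityʳ (pure k i))) (Σ-pure k (λ _ → 1ℚ))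
  where
  pure-nonNeg : (k : Fin n) → ∀ i → 0ℚ ≤ pure k i
  pure-nonNeg zero    zero    = <⇒≤ (positive⁻¹ 1ℚ)
  pure-nonNeg zero    (suc _) = ≤-refl
  pure-nonNeg (suc _) zero    = ≤-refl
  pure-nonNeg (suc k) (suc i) = pure-nonNeg k i

mixed⇒positive : {x : Fin n → ℚ} → IsMixed x → ∃ λ i → 0ℚ < x i
mixed⇒positive {x = x} (_ , Σx≡1) = positive-term x (subst (0ℚ <_) (sym Σx≡1) (positive⁻¹ 1ℚ))

rowValue : Matrix n → (Fin n → ℚ) → Fin n → ℚ
rowValue M y k = Σ λ j → M k j * y j

payoff-rowValue : (M : Matrix n) (x y : Fin n → ℚ) → payoff M x y ≡ Σ (λ i → x i * rowValue M y i)
payoff-rowValue M x y = Σ-cong λ i →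
  trans (Σ-cong λ j → *-assoc (x i) (M i j) (y j)) (Σ-*ˡ (x i) (λ j → M i j * y j))

payoff-pure : (M : Matrix n) (k : Fin n) (y : Fin n → ℚ) → payoff M (pure k) y ≡ rowValue M y k
payoff-pure M k y = trans (payoff-rowValue M (pure k) y) (Σ-pure k (rowValue M y))

transpose : Matrix n → Matrix n
transpose M i j = M j i

payoff-transpose : (M : Matrix n) (x y : Fin n → ℚ) → payoff M x y ≡ payoff (transpose M) y x
payoff-transpose M x y = trans (Σ-swap (λ i j → x i * M i j * y j)) (Σ-cong λ j → Σ-cong λ i → reverse-product (x i) (M i j) (y j))
  where
  reverse-product : ∀ a b c → a * b * c ≡ c * b * a
  reverse-product a b c = begin
    a * b * c    ≡⟨ *-comm (a * b) c ⟩
    c * (a * b)  ≡⟨ cong (c *_) (*-comm a b) ⟩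
    c * (b * a)  ≡⟨ sym (*-assoc c b a) ⟩
    c * b * a    ∎
    where open ≡-Reasoning

BestResponse : Matrix n → (Fin n → ℚ) → (Fin n → ℚ) → Set
BestResponse M x y = ∀ x' → IsMixed x' → payoff M x' y ≤ payoff M x y

column⇒bestResponse : (M : Matrix n) {x y : Fin n → ℚ} →
  (∀ y' → IsMixed y' → payoff M x y' ≤ payoff M x y) → BestResponse (transpose M) y x
column⇒bestResponse M {x} {y} best y' y'-mixed =
  subst₂ _≤_ (payoff-transpose M x y') (payoff-transpose M x y) (best y' y'-mixed)

bestResponse⇒column : (M : Matrix n) {x y : Fin n → ℚ} →
  BestResponse (transpose M) y x → ∀ y' → IsMixed y' → payoff M x y' ≤ payoff M x y
bestResponse⇒column M {x} {y} best y' y'-mixed =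
  subst₂ _≤_ (sym (payoff-transpose M x y')) (sym (payoff-transpose M x y)) (best y' y'-mixed)

OptimalSupport : Matrix n → (Fin n → ℚ) → (Fin n → ℚ) → ℚ → Set
OptimalSupport M x y v = (∀ k → rowValue M y k ≤ v) × (∀ i → 0ℚ < x i → rowValue M y i ≡ v)

-- A best response attains the maximal row value on its support (test it against pure rows).
bestResponse⇒optimal : (M : Matrix n) {x y : Fin n → ℚ} → IsMixed x →
  BestResponse M x y → OptimalSupport M x y (payoff M x y)
bestResponse⇒optimal M {x} {y} x-mixed best = rows≤v , average-≡⇒const x-mixed rows≤v (≤-reflexive (payoff-rowValue M x y))
  where
  rows≤v : ∀ k → rowValue M y k ≤ payoff M x y
  rows≤v k = subst (_≤ payoff M x y) (payoff-pure M k y) (best (pure k) (pure-mixed k))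

optimal⇒bestResponse : (M : Matrix n) {x y : Fin n → ℚ} {v : ℚ} → IsMixed x →
  OptimalSupport M x y v → BestResponse M x y
optimal⇒bestResponse M {x} {y} {v} x-mixed (rows≤v , support≡v) x' x'-mixed = begin
  payoff M x' y                        ≡⟨ payoff-rowValue M x' y ⟩
  Σ (λ i → x' i * rowValue M y i)      ≤⟨ average-≤ x'-mixed rows≤v ⟩
  v                                    ≡⟨ sym (average-const x-mixed v) ⟩
  Σ (λ i → x i * v)                    ≡⟨ sym (Σ-cong (weighted-cong (proj₁ x-mixed) support≡v)) ⟩
  Σ (λ i → x i * rowValue M y i)       ≡⟨ sym (payoff-rowValue M x y) ⟩
  payoff M x y                         ∎
  where open ≤-Reasoning

mask : {P : Pred (Fin n) ℓ} → DecidablePred P → (Fin n → ℚ) → Fin n → ℚ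
mask P? z i = if does (P? i) then z i else 0ℚ

scale : ℚ → (Fin n → ℚ) → Fin n → ℚ
scale t z i = t * z i

restrict : {P : Pred (Fin n) ℓ} → DecidablePred P → ℚ → (Fin n → ℚ) → Fin n → ℚ
restrict P? t z = scale t (mask P? z)

SuppWithin : (Fin n → ℚ) → (Fin n → ℚ) → Pred (Fin n) ℓ → Set ℓ
SuppWithin x' x P = ∀ i → 0ℚ < x' i → 0ℚ < x i × P i

mask-nonNeg : {P : Pred (Fin n) ℓ} (P? : DecidablePred P) {z : Fin n → ℚ} →
              (∀ i → 0ℚ ≤ z i) → ∀ i → 0ℚ ≤ mask P? z i
mask-nonNeg P? z≥0 i with P? i
... | yes _ = z≥0 i
... | no  _ = ≤-refl

restrict-supp : {P : Pred (Fin n) ℓ} (P? : DecidablePred P) {t : ℚ} {z : Fin n → ℚ} →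
                0ℚ ≤ t → SuppWithin (restrict P? t z) z P
restrict-supp P? {t} {z} t≥0 i tzi>0 with P? i | *-pos⇒posʳ t≥0 tzi>0
... | yes Pi | zi>0 = zi>0 , Pi
... | no  _  | 0<0  = contradiction 0<0 (<-irrefl refl)

restrict-mixed : {P : Pred (Fin n) ℓ} (P? : DecidablePred P) {x : Fin n → ℚ} →
  (∀ i → 0ℚ ≤ x i) → (∃ λ i → P i × 0ℚ < x i) → ∃ λ t → 0ℚ ≤ t × IsMixed (restrict P? t x)
restrict-mixed {P = P} P? {x} x≥0 (k , Pk , xk>0) =
  t , <⇒≤ t>0 , (λ i → *-nonNeg (<⇒≤ t>0) (mask-nonNeg P? x≥0 i)) , total
  where
  mass>0 : 0ℚ < Σ (mask P? x)
  mass>0 = Σ-pos (mask-nonNeg P? x≥0) k mask-at-k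
    where
    mask-at-k : 0ℚ < mask P? x k
    mask-at-k with P? k
    ... | yes _   = xk>0
    ... | no  ¬Pk = contradiction Pk ¬Pk
  instance
    mass≢0 : NonZero (Σ (mask P? x))
    mass≢0 = pos⇒nonZero (Σ (mask P? x)) {{positive mass>0}}
  t : ℚ
  t = 1/ Σ (mask P? x)
  t>0 : 0ℚ < t
  t>0 = positive⁻¹ t {{1/pos⇒pos (Σ (mask P? x)) {{positive mass>0}}}}
  total : Σ (restrict P? t x) ≡ 1ℚ
  total = trans (Σ-*ˡ t (mask P? x)) (*-inverseˡ (Σ (mask P? x)))

rowValue-scale : (M : Matrix n) (t : ℚ) (z : Fin n → ℚ) (k : Fin n) →
                 rowValue M (scale t z) k ≡ t * rowValue M z k
rowValue-scale M t z k = trans (Σ-cong swap-scalar) (Σ-*ˡ t (λ j → M k j * z j))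
  where
  swap-scalar : ∀ j → M k j * (t * z j) ≡ t * (M k j * z j)
  swap-scalar j = begin
    M k j * (t * z j)  ≡⟨ sym (*-assoc (M k j) t (z j)) ⟩
    M k j * t * z j    ≡⟨ cong (_* z j) (*-comm (M k j) t) ⟩
    t * M k j * z j    ≡⟨ *-assoc t (M k j) (z j) ⟩
    t * (M k j * z j)  ∎
    where open ≡-Reasoning

rowValue-mask-≤ : {P : Pred (Fin n) ℓ} (P? : DecidablePred P) (M : Matrix n) {y : Fin n → ℚ} →
  NonNegMatrix M → (∀ j → 0ℚ ≤ y j) → ∀ k → rowValue M (mask P? y) k ≤ rowValue M y k
rowValue-mask-≤ P? M {y} M≥0 y≥0 k = Σ-mono term-≤
  where
  term-≤ : ∀ j → M k j * mask P? y j ≤ M k j * y j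
  term-≤ j with P? j
  ... | yes _ = ≤-refl
  ... | no  _ = subst (_≤ M k j * y j) (sym (*-zeroʳ (M k j))) (*-nonNeg (M≥0 k j) (y≥0 j))

rowValue-mask-≡ : {P : Pred (Fin n) ℓ} (P? : DecidablePred P) (M : Matrix n) {y : Fin n → ℚ} →
  (∀ j → 0ℚ ≤ y j) → ∀ k → (∀ j → 0ℚ < y j → ¬ P j → M k j ≡ 0ℚ) →
  rowValue M (mask P? y) k ≡ rowValue M y k
rowValue-mask-≡ P? M {y} y≥0 k no-weight = Σ-cong term-≡
  where
  term-≡ : ∀ j → M k j * mask P? y j ≡ M k j * y j
  term-≡ j with P? j | 0ℚ <? y j
  ... | yes _  | _       = refl
  ... | no ¬Pj | yes yj>0 rewrite no-weight j yj>0 ¬Pj = trans (*-zeroˡ 0ℚ) (sym (*-zeroˡ (y j)))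
  ... | no _   | no yj≯0 rewrite nonNeg-≯0⇒≡0 (y≥0 j) yj≯0 = refl

Separated : Matrix n → (Fin n → ℚ) → (Fin n → ℚ) → Pred (Fin n) ℓ → Pred (Fin n) ℓ → Set ℓ
Separated M x y R C = ∀ {i j} → 0ℚ < x i → R i → 0ℚ < y j → ¬ C j → M i j ≡ 0ℚ

restrict-bestResponse : (M : Matrix n) {R C : Pred (Fin n) ℓ} (C? : DecidablePred C)
  {x y x' : Fin n → ℚ} {t : ℚ} → NonNegMatrix M → (∀ j → 0ℚ ≤ y j) → IsMixed x →
  BestResponse M x y → Separated M x y R C → IsMixed x' → SuppWithin x' x R → 0ℚ ≤ t →
  BestResponse M x' (restrict C? t y)
restrict-bestResponse M C? {x} {y} {x'} {t} M≥0 y≥0 x-mixed best separated x'-mixed within t≥0 =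
  optimal⇒bestResponse M x'-mixed (rows≤ , support≡)
  where
  v : ℚ
  v = payoff M x y
  optimal : OptimalSupport M x y v
  optimal = bestResponse⇒optimal M x-mixed best
  rows≤ : ∀ k → rowValue M (restrict C? t y) k ≤ t * v
  rows≤ k = begin
    rowValue M (restrict C? t y) k  ≡⟨ rowValue-scale M t (mask C? y) k ⟩
    t * rowValue M (mask C? y) k    ≤⟨ *-monoˡ-≤ t≥0 (rowValue-mask-≤ C? M M≥0 y≥0 k) ⟩
    t * rowValue M y k              ≤⟨ *-monoˡ-≤ t≥0 (proj₁ optimal k) ⟩
    t * v                           ∎
    where open ≤-Reasoning
  support≡ : ∀ i → 0ℚ < x' i → rowValue M (restrict C? t y) i ≡ t * v
  support≡ i x'i>0 with within i x'i>0
  ... | xi>0 , Ri = begin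
    rowValue M (restrict C? t y) i  ≡⟨ rowValue-scale M t (mask C? y) i ⟩
    t * rowValue M (mask C? y) i    ≡⟨ cong (t *_) (rowValue-mask-≡ C? M y≥0 i (λ j yj>0 ¬Cj → separated xi>0 Ri yj>0 ¬Cj)) ⟩
    t * rowValue M y i              ≡⟨ cong (t *_) (proj₂ optimal i xi>0) ⟩
    t * v                           ∎
    where open ≡-Reasoning

restrictNash : (A B : Matrix n) {R C : Pred (Fin n) ℓ} {x y : Fin n → ℚ} →
  NonNegMatrix A → NonNegMatrix B → IsNash A B x y →
  DecidablePred R → DecidablePred C → (∃ λ i → R i × 0ℚ < x i) → (∃ λ j → C j × 0ℚ < y j) →
  Separated A x y R C → Separated (transpose B) y x C R →
  ∃₂ λ x' y' → IsNash A B x' y' × SuppWithin x' x R × SuppWithin y' y C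
restrictNash A B {R} {C} {x} {y} A≥0 B≥0 (x-mixed , y-mixed , x-best , y-best) R? C? R∩Sx C∩Sy sepA sepB
  with restrict-mixed R? (proj₁ x-mixed) R∩Sx | restrict-mixed C? (proj₁ y-mixed) C∩Sy
... | s , s≥0 , x'-mixed | t , t≥0 , y'-mixed =
  restrict R? s x , restrict C? t y ,
  (x'-mixed , y'-mixed , x'-best , y'-best) , restrict-supp R? s≥0 , restrict-supp C? t≥0
  where
  x'-best : BestResponse A (restrict R? s x) (restrict C? t y)
  x'-best = restrict-bestResponse A C? A≥0 (proj₁ y-mixed) x-mixed x-best sepA
              x'-mixed (restrict-supp R? s≥0) t≥0
  y'-best : ∀ y'' → IsMixed y'' → payoff B (restrict R? s x) y'' ≤ payoff B (restrict R? s x) (restrict C? t y)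
  y'-best = bestResponse⇒column B
              (restrict-bestResponse (transpose B) R? (λ i j → B≥0 j i) (proj₁ x-mixed) y-mixed
                (column⇒bestResponse B y-best) sepB y'-mixed (restrict-supp C? t≥0) s≥0)

minimal⇒supportWithin : (A B : Matrix n) {R C : Pred (Fin n) ℓ} {x y : Fin n → ℚ} →
  NonNegMatrix A → NonNegMatrix B → IsMinimalNash A B x y →
  DecidablePred R → DecidablePred C → (∃ λ i → R i × 0ℚ < x i) → (∃ λ j → C j × 0ℚ < y j) →
  Separated A x y R C → Separated (transpose B) y x C R →
  (∀ i → 0ℚ < x i → R i) × (∀ j → 0ℚ < y j → C j)
minimal⇒supportWithin A B {R} {C} {x} {y} A≥0 B≥0 (nash , minimal) R? C? R∩Sx C∩Sy sepA sepB =
  shrink (restrictNash A B A≥0 B≥0 nash R? C? R∩Sx C∩Sy sepA sepB)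
  where
  shrink : (∃₂ λ x' y' → IsNash A B x' y' × SuppWithin x' x R × SuppWithin y' y C) →
           (∀ i → 0ℚ < x i → R i) × (∀ j → 0ℚ < y j → C j)
  shrink (x' , y' , nash' , x'-within , y'-within) =
    (λ i → proj₂ ∘ x'-within i ∘ Sx⊆Sx' i) , (λ j → proj₂ ∘ y'-within j ∘ Sy⊆Sy' j)
    where
    same : SuppEq x' x × SuppEq y' y
    same = minimal x' y' nash' (λ i → proj₁ ∘ x'-within i) (λ j → proj₁ ∘ y'-within j)
    Sx⊆Sx' : SuppSubset x x'
    Sx⊆Sx' = proj₂ (proj₁ same)
    Sy⊆Sy' : SuppSubset y y'
    Sy⊆Sy' = proj₂ (proj₂ same)

-- Starting from {u},
-- repeatedly add the endpoint of an E-edge leaving the current set; each step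
-- enlarges the set, so after at most m steps no edge leaves it.
module Components {m : ℕ} {E : Rel (Fin m) ℓ} (E? : Decidable E) where

  Closed : Subset m → Set ℓ
  Closed p = ∀ {v w} → v ∈ p → E v w → w ∈ p

  ReachableFrom : Fin m → Subset m → Set ℓ
  ReachableFrom u p = ∀ {v} → v ∈ p → Star E u v

  Component : Fin m → Subset m → Set ℓ
  Component u p = u ∈ p × Closed p × ReachableFrom u p

  Exit : Subset m → Set ℓ
  Exit p = ∃₂ λ v w → v ∈ p × w ∉ p × E v w

  exit? : ∀ p → Dec (Exit p)
  exit? p = any? λ v → any? λ w → v ∈? p ×-dec ¬? (w ∈? p) ×-dec E? v w

  -- The fuel k bounds the number of remaining growth steps: m < k + |p|.
  saturate : ∀ k {u} p → m ℕ.< k ℕ.+ ∣ p ∣ → u ∈ p → ReachableFrom u p → ∃ (Component u)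
  saturate ℕ.zero    p bound _ _ = contradiction (∣p∣≤n p) (ℕ.<⇒≱ bound)
  saturate (ℕ.suc k) {u} p bound u∈p reach with exit? p
  ... | no noExit = p , u∈p , (λ v∈p e → decidable-stable (_ ∈? p) λ w∉p → noExit (_ , _ , v∈p , w∉p , e)) , reach
  ... | yes (v , w , v∈p , w∉p , e) = saturate k (p ∪ ⁅ w ⁆) bound′ (p⊆p∪q ⁅ w ⁆ u∈p) reach′
    where
    grows : p ⊂ p ∪ ⁅ w ⁆
    grows = p⊆p∪q ⁅ w ⁆ , w , q⊆p∪q p ⁅ w ⁆ (x∈⁅x⁆ w) , w∉p
    bound′ : m ℕ.< k ℕ.+ ∣ p ∪ ⁅ w ⁆ ∣
    bound′ = ℕ.<-≤-trans bound (ℕ.≤-trans (ℕ.≤-reflexive (sym (ℕ.+-suc k ∣ p ∣)))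
                                          (ℕ.+-monoʳ-≤ k (p⊂q⇒∣p∣<∣q∣ grows)))
    reach′ : ReachableFrom u (p ∪ ⁅ w ⁆)
    reach′ {z} z∈p′ with x∈p∪q⁻ p ⁅ w ⁆ z∈p′
    ... | inj₁ z∈p = reach z∈p
    ... | inj₂ z∈w rewrite x∈⁅y⁆⇒x≡y w z∈w = reach v∈p ◅◅ e ◅ ε

  component : ∀ u → ∃ (Component u)
  component u = saturate m ⁅ u ⁆ bound (x∈⁅x⁆ u) reach
    where
    bound : m ℕ.< m ℕ.+ ∣ ⁅ u ⁆ ∣
    bound = subst (m ℕ.<_) (sym (cong (m ℕ.+_) (∣⁅x⁆∣≡1 u))) (ℕ.m<m+n m ℕ.z<s)
    reach : ReachableFrom u ⁅ u ⁆
    reach v∈u rewrite x∈⁅y⁆⇒x≡y u v∈u = ε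

-- Components carry over to any type V encoded into some Fin m: the component of u
-- is the decidable set of those v whose code lies in a subset p of Fin m.
module EncodedComponents {V : Set} {m : ℕ} (code : V → Fin m) (decode : Fin m → V)
  (decode-code : ∀ v → decode (code v) ≡ v) {E : Rel V ℓ} (E? : Decidable E) where

  private
    E-on-codes : Rel (Fin m) ℓ
    E-on-codes i j = E (decode i) (decode j)

  open Components {E = E-on-codes} (λ i j → E? (decode i) (decode j)) using (component)

  componentOf : ∀ u → ∃ λ (p : Subset m) →
    code u ∈ p × (∀ {v w} → code v ∈ p → E v w → code w ∈ p) × (∀ {v} → code v ∈ p → Star E u v)
  componentOf u with component (code u)
  ... | p , u∈p , closed , reach = p , u∈p , closed′ , reach′
    where
    closed′ : ∀ {v w} → code v ∈ p → E v w → code w ∈ p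
    closed′ {v} {w} v∈p e = closed v∈p (subst₂ E (sym (decode-code v)) (sym (decode-code w)) e)
    reach′ : ∀ {v} → code v ∈ p → Star E u v
    reach′ {v} v∈p = subst₂ (Star E) (decode-code u) (decode-code v) (gmap decode (λ e → e) (reach v∈p))

module InducedGraph {n : ℕ} (A B : Matrix n) (x y : Fin n → ℚ) where

  Edge : Rel (Vertex n) 0ℓ
  Edge = InducedEdge A B x y

  inSupport? : ∀ v → Dec (InSxSy x y v)
  inSupport? (inj₁ i) = 0ℚ <? x i
  inSupport? (inj₂ j) = 0ℚ <? y j

  rowColumn? : ∀ i j → Dec (RCAdj A B i j)
  rowColumn? i j = ¬? (A i j ≟ 0ℚ) ⊎-dec ¬? (B i j ≟ 0ℚ)

  adjacent? : ∀ u v → Dec (Adj A B u v)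
  adjacent? (inj₁ i) (inj₂ j) = rowColumn? i j
  adjacent? (inj₂ j) (inj₁ i) = rowColumn? i j
  adjacent? (inj₁ _) (inj₁ _) = no λ ()
  adjacent? (inj₂ _) (inj₂ _) = no λ ()

  edge? : Decidable Edge
  edge? u v = inSupport? u ×-dec inSupport? v ×-dec adjacent? u v

  edge-sym : ∀ {u v} → Edge u v → Edge v u
  edge-sym {inj₁ _} {inj₂ _} (u∈S , v∈S , adj) = v∈S , u∈S , adj
  edge-sym {inj₂ _} {inj₁ _} (u∈S , v∈S , adj) = v∈S , u∈S , adj

  EdgeClosed : Pred (Vertex n) ℓ → Set ℓ
  EdgeClosed R = ∀ {v w} → R v → Edge v w → R w

  -- In a closed vertex set, retained support rows have zero A-entries towards discarded
  -- support columns (they would be edges), and symmetrically for B.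
  closed⇒separated : {R : Pred (Vertex n) ℓ} → EdgeClosed R →
    Separated A x y (R ∘ inj₁) (R ∘ inj₂) × Separated (transpose B) y x (R ∘ inj₂) (R ∘ inj₁)
  closed⇒separated closed =
    (λ {i} {j} xi>0 Ri yj>0 ¬Cj → decidable-stable (A i j ≟ 0ℚ) λ Aij≢0 → ¬Cj (closed Ri (xi>0 , yj>0 , inj₁ Aij≢0))) ,
    (λ {j} {i} yj>0 Cj xi>0 ¬Ri → decidable-stable (B i j ≟ 0ℚ) λ Bij≢0 → ¬Ri (closed Cj (yj>0 , xi>0 , inj₂ Bij≢0)))

  -- Vertices are encoded into Fin (n + n), so induced components exist.
  open EncodedComponents (join n n) (splitAt n) (splitAt-join n n) edge? public using (componentOf)

module MinimalEquilibrium {n : ℕ} (A B : Matrix n) (x y : Fin n → ℚ)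
  (A≥0 : NonNegMatrix A) (B≥0 : NonNegMatrix B) (minimal : IsMinimalNash A B x y) where

  open InducedGraph A B x y

  support⊆closed : {R : Pred (Vertex n) ℓ} → DecidablePred R → EdgeClosed R →
    (∃ λ i → R (inj₁ i) × 0ℚ < x i) → (∃ λ j → R (inj₂ j) × 0ℚ < y j) →
    ∀ v → InSxSy x y v → R v
  support⊆closed {R = R} R? closed R∩Sx R∩Sy = support⊆R
    where
    within : (∀ i → 0ℚ < x i → R (inj₁ i)) × (∀ j → 0ℚ < y j → R (inj₂ j))
    within = minimal⇒supportWithin A B A≥0 B≥0 minimal (R? ∘ inj₁) (R? ∘ inj₂) R∩Sx R∩Sy
               (proj₁ (closed⇒separated closed)) (proj₂ (closed⇒separated closed))
    support⊆R : ∀ v → InSxSy x y v → R v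
    support⊆R (inj₁ i) = proj₁ within i
    support⊆R (inj₂ j) = proj₂ within j

  edge⇒connected : ∀ {i j} → Edge (inj₁ i) (inj₂ j) → InducedConnected A B x y
  edge⇒connected {i} {j} e with componentOf (inj₁ i)
  ... | p , i∈p , closed , reach = λ v w v∈S w∈S → reverse edge-sym (reach (in-p v v∈S)) ◅◅ reach (in-p w w∈S)
    where
    in-p : ∀ v → InSxSy x y v → join n n v ∈ p
    in-p = support⊆closed (λ v → join n n v ∈? p) closed
             (i , i∈p , proj₁ e) (j , closed {inj₁ i} {inj₂ j} i∈p e , proj₁ (proj₂ e))

  -- If neither i₀ ∈ S(x) nor j₀ ∈ S(y) has a neighbour in the induced subgraph,
  -- then {i₀, j₀} is closed, so the supports are {i₀} and {j₀}.
  isolated⇒singletons : ∀ {i₀ j₀} → 0ℚ < x i₀ → 0ℚ < y j₀ →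
    ¬ (∃ λ j → Edge (inj₁ i₀) (inj₂ j)) → ¬ (∃ λ i → Edge (inj₂ j₀) (inj₁ i)) →
    SupportSizeOne x × SupportSizeOne y
  isolated⇒singletons {i₀} {j₀} xi₀>0 yj₀>0 no-row-edge no-column-edge =
    (i₀ , xi₀>0 , λ i xi>0 → row (in-pair (inj₁ i) xi>0)) ,
    (j₀ , yj₀>0 , λ j yj>0 → column (in-pair (inj₂ j) yj>0))
    where
    Pair : Pred (Vertex n) 0ℓ
    Pair v = v ≡ inj₁ i₀ ⊎ v ≡ inj₂ j₀
    pair? : DecidablePred Pair
    pair? v = (v ≟V inj₁ i₀) ⊎-dec (v ≟V inj₂ j₀)
      where
      _≟V_ : (u v : Vertex n) → Dec (u ≡ v)
      _≟V_ = ≡-dec Fin._≟_ Fin._≟_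
    closed : EdgeClosed Pair
    closed {w = inj₂ j} (inj₁ refl) e = contradiction (j , e) no-row-edge
    closed {w = inj₁ i} (inj₂ refl) e = contradiction (i , e) no-column-edge
    closed {w = inj₁ _} (inj₁ refl) (_ , _ , ())
    closed {w = inj₂ _} (inj₂ refl) (_ , _ , ())
    in-pair : ∀ v → InSxSy x y v → Pair v
    in-pair = support⊆closed pair? closed (i₀ , inj₁ refl , xi₀>0) (j₀ , inj₂ refl , yj₀>0)
    row : ∀ {i} → Pair (inj₁ i) → i ≡ i₀
    row (inj₁ refl) = refl
    column : ∀ {j} → Pair (inj₂ j) → j ≡ j₀
    column (inj₂ refl) = refl

lemma6 : (n : ℕ) (A B : Matrix n) → NonNegMatrix A → NonNegMatrix B →
         (x y : Fin n → ℚ) → IsMinimalNash A B x y →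
         (SupportSizeOne x × SupportSizeOne y) ⊎ InducedConnected A B x y
lemma6 n A B A≥0 B≥0 x y minimal@((x-mixed , y-mixed , _) , _) =
  by-neighbours (mixed⇒positive x-mixed) (mixed⇒positive y-mixed)
  where
  open InducedGraph A B x y
  open MinimalEquilibrium A B x y A≥0 B≥0 minimal

  by-neighbours : (∃ λ i → 0ℚ < x i) → (∃ λ j → 0ℚ < y j) →
                  (SupportSizeOne x × SupportSizeOne y) ⊎ InducedConnected A B x y
  by-neighbours (i₀ , xi₀>0) (j₀ , yj₀>0)
    with any? (λ j → edge? (inj₁ i₀) (inj₂ j)) | any? (λ i → edge? (inj₂ j₀) (inj₁ i))
  ... | yes (j , e) | _           = inj₂ (edge⇒connected e)
  ... | no _        | yes (i , e) = inj₂ (edge⇒connected (edge-sym {inj₂ j₀} {inj₁ i} e))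
  ... | no no-row   | no no-col   = inj₁ (isolated⇒singletons xi₀>0 yj₀>0 no-row no-col)
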